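{- Let $n\geq3$. For a partition $\vec\alpha$ of $n$ define its sons: the left son $\vec\alpha^{\downarrow_1}$, and, if it exists, the right son, which is $\vec\alpha^{\downarrow_2}$ if $\vec\alpha\in\mathrm{Ss}(n)\cup\mathrm{NS}(n)$, is $\vec\alpha^{\downarrow_{l+2}}$ if $\vec\alpha\in\mathrm{PP}_l(n)$ for some $l\geq1$, and does not exist otherwise. Then for every $\vec\alpha\in\mathcal{J}(\mathcal{L}_n)\setminus\{(2,1,\ldots,1)\}$, exactly one of its sons belongs to $\mathcal{J}(\mathcal{L}_{n+1})$; moreover, the partition $(2,1,\ldots,1)\in\mathcal{J}(\mathcal{L}_n)$ has two sons, both belonging to $\mathcal{J}(\mathcal{L}_{n+1})$.
   Context: A partition of a positive integer $n$ is an $n$-tuple $\vec\alpha=(a_1,\ldots,a_n)$ of natural numbers with $a_1\geq\cdots\geq a_n\geq0$ and $\sum a_i=n$ (trailing zeros may be omitted; $a_i=0$ for $i>n$). The dominance ordering: $(a_i)\geq(b_i)$ iff $\sum_{i=1}^j a_i\geq\sum_{i=1}^j b_i$ for all $j\geq1$; the partitions of $n$ form a lattice $\mathcal{L}_n$, and $\mathcal{J}(\mathcal{L}_n)$ is its set of join-irreducible elements (elements covering exactly one element). $(2,1,\ldots,1)$ denotes the partition of $n$ with one part $2$ and $n-2$ parts $1$. For $i\in\{1,\ldots,n\}$, $\vec\alpha^{\downarrow_i}=(a_1,\ldots,a_i+1,\ldots,a_n,0)$ and $\vec\alpha^{\downarrow_{n+1}}=(a_1,\ldots,a_n,1)$.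 Let $d_j(\vec\alpha)=a_j-a_{j+1}$. $\vec\alpha$ has a cliff at $j$ if $d_j(\vec\alpha)\geq2$; a slippery plateau of length $k-j$ at $j$ if there is $k>j$ with $d_i(\vec\alpha)=0$ for $i\in\{j,\ldots,k-1\}$ and $d_k(\vec\alpha)=1$; a non-slippery plateau at $j$ if there is $k>j$ with $d_i(\vec\alpha)=0$ for $i\in\{j,\ldots,k-1\}$ and a cliff at $k$; a slippery (resp. non-slippery) step at $j$ if $(a_1,\ldots,a_j-1,\ldots,a_n)$ is a partition with a slippery (resp. non-slippery) plateau at $j$. $\mathrm{Ss}(n)$, $\mathrm{NS}(n)$, $\mathrm{PP}_l(n)$ are the sets of partitions of $n$ with a slippery step at $1$, a non-slippery step at $1$, and a slippery plateau of length $l$ at $1$, respectively. -}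

module Defs where

open import Data.Nat using (ℕ; zero; suc; _+_; _∸_; _≤_; _<_; pred)
open import Data.Vec using (Vec; []; _∷_; _∷ʳ_; replicate; sum)
open import Data.Product using (Σ; ∃; _×_)
open import Data.Sum using (_⊎_)
open import Relation.Binary.PropositionalEquality using (_≡_; _≢_)
open import Relation.Nullary using (¬_)

-- 1-indexed entry a_i of a tuple; a_0 and a_i for i > length are 0.
at : ∀ {n} → Vec ℕ n → ℕ → ℕ
at []      _               = 0
at (x ∷ v) zero            = 0
at (x ∷ v) (suc zero)      = x
at (x ∷ v) (suc (suc i))   = at v (suc i)

incr : ∀ {n} → Vec ℕ n → ℕ → Vec ℕ n
incr []      _             = []
incr (x ∷ v) zero          = x ∷ v
incr (x ∷ v) (suc zero)    = suc x ∷ v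
incr (x ∷ v) (suc (suc i)) = x ∷ incr v (suc i)

decr : ∀ {n} → Vec ℕ n → ℕ → Vec ℕ n
decr []      _             = []
decr (x ∷ v) zero          = x ∷ v
decr (x ∷ v) (suc zero)    = pred x ∷ v
decr (x ∷ v) (suc (suc i)) = x ∷ decr v (suc i)

-- α^{↓i} = (a_1, …, a_i + 1, …, a_n, 0) for 1 ≤ i ≤ n, and (a_1, …, a_n, 1) for i = n+1
down : ∀ {n} → Vec ℕ n → ℕ → Vec ℕ (suc n)
down v i = incr (v ∷ʳ 0) i

NonIncreasing : ∀ {n} → Vec ℕ n → Set
NonIncreasing v = ∀ i → 1 ≤ i → at v (suc i) ≤ at v i

IsPartition : (n : ℕ) → Vec ℕ n → Set
IsPartition n v = NonIncreasing v × sum v ≡ n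

psum : ∀ {n} → Vec ℕ n → ℕ → ℕ
psum v zero    = 0
psum v (suc j) = psum v j + at v (suc j)

_⊴_ : ∀ {n} → Vec ℕ n → Vec ℕ n → Set
β ⊴ α = ∀ j → psum β j ≤ psum α j

_◁_ : ∀ {n} → Vec ℕ n → Vec ℕ n → Set
β ◁ α = β ⊴ α × β ≢ α

Covers : (n : ℕ) → Vec ℕ n → Vec ℕ n → Set
Covers n α β = IsPartition n β × β ◁ α
             × ¬ (Σ (Vec ℕ n) λ γ → IsPartition n γ × β ◁ γ × γ ◁ α)

JoinIrr : (n : ℕ) → Vec ℕ n → Set
JoinIrr n α = IsPartition n α
            × Σ (Vec ℕ n) λ β → Covers n α β × (∀ γ → Covers n α γ → γ ≡ β)

d : ∀ {n} → Vec ℕ n → ℕ → ℕ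
d v j = at v j ∸ at v (suc j)

Cliff : ∀ {n} → Vec ℕ n → ℕ → Set
Cliff v j = 2 ≤ d v j

SlipPlateauLen : ∀ {n} → Vec ℕ n → ℕ → ℕ → Set
SlipPlateauLen v l j = 1 ≤ l × (∀ i → j ≤ i → i < j + l → d v i ≡ 0) × d v (j + l) ≡ 1

SlipPlateau : ∀ {n} → Vec ℕ n → ℕ → Set
SlipPlateau v j = ∃ λ l → SlipPlateauLen v l j

NonSlipPlateau : ∀ {n} → Vec ℕ n → ℕ → Set
NonSlipPlateau v j = ∃ λ k → j < k × (∀ i → j ≤ i → i < k → d v i ≡ 0) × Cliff v k

SlipStep : ∀ {n} → Vec ℕ n → ℕ → Set
SlipStep v j = 1 ≤ at v j × NonIncreasing (decr v j) × SlipPlateau (decr v j) j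

NonSlipStep : ∀ {n} → Vec ℕ n → ℕ → Set
NonSlipStep v j = 1 ≤ at v j × NonIncreasing (decr v j) × NonSlipPlateau (decr v j) j

Ss : (n : ℕ) → Vec ℕ n → Set
Ss n α = IsPartition n α × SlipStep α 1

NS : (n : ℕ) → Vec ℕ n → Set
NS n α = IsPartition n α × NonSlipStep α 1

PP : ℕ → (n : ℕ) → Vec ℕ n → Set
PP l n α = IsPartition n α × SlipPlateauLen α l 1

leftSon : ∀ {n} → Vec ℕ n → Vec ℕ (suc n)
leftSon α = down α 1

RightSon : (n : ℕ) → Vec ℕ n → Vec ℕ (suc n) → Set
RightSon n α β = ((Ss n α ⊎ NS n α) × β ≡ down α 2)
               ⊎ Σ ℕ λ l → 1 ≤ l × PP l n α × β ≡ down α (l + 2)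

twoOnes : (n : ℕ) → Vec ℕ n
twoOnes zero          = []
twoOnes (suc zero)    = 1 ∷ []   -- irrelevant (n ≥ 3 in use)
twoOnes (suc (suc m)) = 2 ∷ (replicate m 1 ∷ʳ 0)

-- By Brylawski's description of covers in the dominance order, β is covered by α exactly
-- when β arises from α by moving one cell from a row i down to a row j, where either j = i + 1
-- and a_i ≥ a_j + 2, or a_i − 1 = a_k = a_j + 1 for all i < k < j; hence α is join-irreducible
-- iff all such moves start in the same row.  For join-irreducible α, let a_1 = … = a_k be its
-- first plateau.  If a cliff follows it, the left son keeps exactly the move of α at row k, and
-- α is neither a step at 1 nor a slippery plateau, so it has no right son.  Otherwise
-- a_{k+1} = a_1 − 1 and the left son gains a move from row 1, next to the move of α, which
-- starts at a row ≥ 2 unless α = (2,1,…,1).  The right son, obtained by raising a_{k+1} to a_1,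
-- has a single move: at the end of the second plateau if a cliff follows that one, and from
-- row k + 1 otherwise; in the latter case uniqueness of moves in α forces a_1 = 2 and all later
-- parts ≤ 1, which for k = 1 means α = (2,1,…,1).
module Submission where

open import Defs
open import Data.Nat
open import Data.Nat.Properties
open import Data.Vec using (Vec; []; _∷_; _∷ʳ_; replicate; sum)
open import Data.Vec.Properties using (≡-dec)
open import Data.Product
open import Data.Sum
open import Data.Empty
open import Function using (_∘_; id)
open import Relation.Binary.PropositionalEquality
open import Relation.Nullary
open import Relation.Nullary.Decidable using (decidable-stable)
open import Relation.Unary using (Decidable)
open import Relation.Binary.Definitions using (Tri; tri<; tri≈; tri>)

at-out : ∀ {n} (v : Vec ℕ n) {m} → n < m → at v m ≡ 0
at-out []           _                     = refl
at-out (x ∷ v)      {suc zero}    (s≤s ())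
at-out (x ∷ [])     {suc (suc m)} _       = refl
at-out (x ∷ y ∷ v)  {suc (suc m)} (s≤s p) = at-out (y ∷ v) p

at-∷ʳ0 : ∀ {n} (v : Vec ℕ n) m → at (v ∷ʳ 0) m ≡ at v m
at-∷ʳ0 []      zero          = refl
at-∷ʳ0 []      (suc zero)    = refl
at-∷ʳ0 []      (suc (suc m)) = refl
at-∷ʳ0 (x ∷ v) zero          = refl
at-∷ʳ0 (x ∷ v) (suc zero)    = refl
at-∷ʳ0 (x ∷ v) (suc (suc m)) = at-∷ʳ0 v (suc m)

at-incr-≢ : ∀ {n} (v : Vec ℕ n) {i m} → m ≢ i → at (incr v i) m ≡ at v m
at-incr-≢ []      _                                  = refl
at-incr-≢ (x ∷ v) {zero}                             _  = refl
at-incr-≢ (x ∷ v) {suc zero}    {zero}               _  = refl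
at-incr-≢ (x ∷ v) {suc zero}    {suc zero}           ne = ⊥-elim (ne refl)
at-incr-≢ (x ∷ v) {suc zero}    {suc (suc m)}        _  = refl
at-incr-≢ (x ∷ v) {suc (suc i)} {zero}               _  = refl
at-incr-≢ (x ∷ v) {suc (suc i)} {suc zero}           _  = refl
at-incr-≢ (x ∷ v) {suc (suc i)} {suc (suc m)}        ne = at-incr-≢ v (λ e → ne (cong suc e))

at-incr-≡ : ∀ {n} (v : Vec ℕ n) {i} → 1 ≤ i → i ≤ n → at (incr v i) i ≡ suc (at v i)
at-incr-≡ (x ∷ v) {suc zero}    _ _       = refl
at-incr-≡ (x ∷ v) {suc (suc i)} _ (s≤s p) = at-incr-≡ v (s≤s z≤n) p

at-decr-≢ : ∀ {n} (v : Vec ℕ n) {i m} → m ≢ i → at (decr v i) m ≡ at v m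
at-decr-≢ []      _                                  = refl
at-decr-≢ (x ∷ v) {zero}                             _  = refl
at-decr-≢ (x ∷ v) {suc zero}    {zero}               _  = refl
at-decr-≢ (x ∷ v) {suc zero}    {suc zero}           ne = ⊥-elim (ne refl)
at-decr-≢ (x ∷ v) {suc zero}    {suc (suc m)}        _  = refl
at-decr-≢ (x ∷ v) {suc (suc i)} {zero}               _  = refl
at-decr-≢ (x ∷ v) {suc (suc i)} {suc zero}           _  = refl
at-decr-≢ (x ∷ v) {suc (suc i)} {suc (suc m)}        ne = at-decr-≢ v (λ e → ne (cong suc e))

at-decr-≡ : ∀ {n} (v : Vec ℕ n) i → at (decr v i) i ≡ pred (at v i)
at-decr-≡ []      _             = refl
at-decr-≡ (x ∷ v) zero          = refl
at-decr-≡ (x ∷ v) (suc zero)    = refl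
at-decr-≡ (x ∷ v) (suc (suc i)) = at-decr-≡ v (suc i)

at-ext : ∀ {n} (v w : Vec ℕ n) → (∀ m → 1 ≤ m → at v m ≡ at w m) → v ≡ w
at-ext []      []      _ = refl
at-ext (x ∷ v) (y ∷ w) h =
  cong₂ _∷_ (h 1 ≤-refl) (at-ext v w λ { (suc m) _ → h (suc (suc m)) (s≤s z≤n) })

sum-∷ʳ0 : ∀ {n} (v : Vec ℕ n) → sum (v ∷ʳ 0) ≡ sum v
sum-∷ʳ0 []      = refl
sum-∷ʳ0 (x ∷ v) = cong (x +_) (sum-∷ʳ0 v)

sum-incr : ∀ {n} (v : Vec ℕ n) {i} → 1 ≤ i → i ≤ n → sum (incr v i) ≡ suc (sum v)
sum-incr (x ∷ v) {suc zero}    _ _       = refl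
sum-incr (x ∷ v) {suc (suc i)} _ (s≤s p) =
  trans (cong (x +_) (sum-incr v (s≤s z≤n) p)) (+-suc x (sum v))

sum-decr : ∀ {n} (v : Vec ℕ n) {i} → 1 ≤ i → 1 ≤ at v i → suc (sum (decr v i)) ≡ sum v
sum-decr (suc x ∷ v) {suc zero}    _ _ = refl
sum-decr (x ∷ v)     {suc (suc i)} _ p =
  trans (sym (+-suc x _)) (cong (x +_) (sum-decr v (s≤s z≤n) p))

psum-∷ : ∀ {n} x (v : Vec ℕ n) j → psum (x ∷ v) (suc j) ≡ x + psum v j
psum-∷ x v zero    = sym (+-identityʳ x)
psum-∷ x v (suc j) = trans (cong (_+ at v (suc j)) (psum-∷ x v j)) (+-assoc x _ _)

psum-sum : ∀ {n} (v : Vec ℕ n) {m} → n ≤ m → psum v m ≡ sum v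
psum-sum []      {zero}  _       = refl
psum-sum []      {suc m} _       = trans (+-identityʳ _) (psum-sum [] {m} z≤n)
psum-sum (x ∷ v) {suc m} (s≤s p) = trans (psum-∷ x v m) (cong (x +_) (psum-sum v p))

psum-mono : ∀ {n} (v : Vec ℕ n) {m m′} → m ≤ m′ → psum v m ≤ psum v m′
psum-mono v {m′ = zero}  z≤n = ≤-refl
psum-mono v {m′ = suc m′} p with m≤n⇒m<n∨m≡n p
... | inj₂ refl       = ≤-refl
... | inj₁ (s≤s m≤m′) = ≤-trans (psum-mono v m≤m′) (m≤m+n (psum v m′) (at v (suc m′)))

psum-≤-sum : ∀ {n} (v : Vec ℕ n) m → psum v m ≤ sum v
psum-≤-sum {n} v m = ≤-trans (psum-mono v (m≤m+n m n)) (≤-reflexive (psum-sum v (m≤n+m n m)))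

psum-injective : ∀ {n} (v w : Vec ℕ n) → (∀ m → psum v m ≡ psum w m) → v ≡ w
psum-injective v w h = at-ext v w λ { (suc m) _ →
  +-cancelˡ-≡ (psum v m) _ _ (trans (h (suc m)) (cong (_+ at w (suc m)) (sym (h m)))) }

psum-incr-< : ∀ {n} (v : Vec ℕ n) {i m} → m < i → psum (incr v i) m ≡ psum v m
psum-incr-< v {m = zero}  _ = refl
psum-incr-< v {m = suc m} p = cong₂ _+_ (psum-incr-< v (<⇒≤ p)) (at-incr-≢ v (<⇒≢ p))

psum-incr-≥ : ∀ {n} (v : Vec ℕ n) {i m} → 1 ≤ i → i ≤ n → i ≤ m → psum (incr v i) m ≡ suc (psum v m)
psum-incr-≥ v {i} {zero}  i≥1 _ p = ⊥-elim (1+n≰n (≤-trans i≥1 p))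
psum-incr-≥ v {i} {suc m} i≥1 i≤n p with m≤n⇒m<n∨m≡n p
... | inj₂ refl =
  trans (cong₂ _+_ (psum-incr-< v {m = m} ≤-refl) (at-incr-≡ v i≥1 i≤n)) (+-suc (psum v m) _)
... | inj₁ (s≤s i≤m) =
  cong₂ _+_ (psum-incr-≥ v i≥1 i≤n i≤m) (at-incr-≢ v {i} {suc m} (λ e → 1+n≰n (subst (_≤ m) (sym e) i≤m)))

psum-decr-< : ∀ {n} (v : Vec ℕ n) {i m} → m < i → psum (decr v i) m ≡ psum v m
psum-decr-< v {m = zero}  _ = refl
psum-decr-< v {m = suc m} p = cong₂ _+_ (psum-decr-< v (<⇒≤ p)) (at-decr-≢ v (<⇒≢ p))

psum-decr-≥ : ∀ {n} (v : Vec ℕ n) {i m} → 1 ≤ i → 1 ≤ at v i → i ≤ m → suc (psum (decr v i) m) ≡ psum v m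
psum-decr-≥ v {i} {zero}  i≥1 _ p = ⊥-elim (1+n≰n (≤-trans i≥1 p))
psum-decr-≥ v {i} {suc m} i≥1 vi≥1 p with m≤n⇒m<n∨m≡n p
... | inj₂ refl = begin
  suc (psum (decr v i) m + at (decr v i) i) ≡⟨ cong₂ (λ a b → suc (a + b)) (psum-decr-< v {m = m} ≤-refl) (at-decr-≡ v i) ⟩
  suc (psum v m + pred (at v i))            ≡⟨ sym (+-suc (psum v m) _) ⟩
  psum v m + suc (pred (at v i))            ≡⟨ cong (psum v m +_) (suc-pred (at v i) {{>-nonZero vi≥1}}) ⟩
  psum v m + at v i                         ∎
  where open ≡-Reasoning
... | inj₁ (s≤s i≤m) =
  cong₂ _+_ (psum-decr-≥ v i≥1 vi≥1 i≤m) (at-decr-≢ v {i} {suc m} (λ e → 1+n≰n (subst (_≤ m) (sym e) i≤m)))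

at-decr-≤ : ∀ {n} (v : Vec ℕ n) i m → at (decr v i) m ≤ at v m
at-decr-≤ v i m with m ≟ i
... | yes refl = ≤-trans (≤-reflexive (at-decr-≡ v i)) pred[n]≤n
... | no m≢i   = ≤-reflexive (at-decr-≢ v m≢i)

at-≤-incr : ∀ {n} (v : Vec ℕ n) {r} → 1 ≤ r → r ≤ n → ∀ m → at v m ≤ at (incr v r) m
at-≤-incr v {r} r≥1 r≤n m with m ≟ r
... | yes refl = ≤-trans (n≤1+n _) (≤-reflexive (sym (at-incr-≡ v r≥1 r≤n)))
... | no m≢r   = ≤-reflexive (sym (at-incr-≢ v m≢r))

decr-nonIncreasing : ∀ {n} (v : Vec ℕ n) {i} → NonIncreasing v → at v (suc i) < at v i → NonIncreasing (decr v i)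
decr-nonIncreasing v {i} anti descent k k≥1 with k ≟ i
... | yes refl = ≤-trans (≤-reflexive (at-decr-≢ v (λ e → 1+n≰n (≤-reflexive e))))
                         (≤-trans (<⇒≤pred descent) (≤-reflexive (sym (at-decr-≡ v k))))
... | no k≢i   = ≤-trans (at-decr-≤ v i (suc k)) (≤-trans (anti k k≥1) (≤-reflexive (sym (at-decr-≢ v k≢i))))

incr-nonIncreasing : ∀ {n} (v : Vec ℕ n) {r} → NonIncreasing v → 1 ≤ r → r ≤ n →
                     (∀ k → 1 ≤ k → suc k ≡ r → at v r < at v k) → NonIncreasing (incr v r)
incr-nonIncreasing v {r} anti r≥1 r≤n room k k≥1 with suc k ≟ r
... | yes refl = ≤-trans (≤-reflexive (at-incr-≡ v r≥1 r≤n)) (≤-trans (room k k≥1 refl) (at-≤-incr v r≥1 r≤n k))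
... | no k+1≢r = ≤-trans (≤-reflexive (at-incr-≢ v k+1≢r)) (≤-trans (anti k k≥1) (at-≤-incr v r≥1 r≤n k))

at-down-≡ : ∀ {n} (v : Vec ℕ n) {r} → 1 ≤ r → r ≤ suc n → at (down v r) r ≡ suc (at v r)
at-down-≡ v r≥1 r≤n+1 = trans (at-incr-≡ (v ∷ʳ 0) r≥1 r≤n+1) (cong suc (at-∷ʳ0 v _))

at-down-≢ : ∀ {n} (v : Vec ℕ n) {r m} → m ≢ r → at (down v r) m ≡ at v m
at-down-≢ v {m = m} m≢r = trans (at-incr-≢ (v ∷ʳ 0) m≢r) (at-∷ʳ0 v m)

at-≤-down : ∀ {n} (v : Vec ℕ n) {r} → 1 ≤ r → r ≤ suc n → ∀ m → at v m ≤ at (down v r) m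
at-≤-down v r≥1 r≤n+1 m = ≤-trans (≤-reflexive (sym (at-∷ʳ0 v m))) (at-≤-incr (v ∷ʳ 0) r≥1 r≤n+1 m)

down-isPartition : ∀ {n} (v : Vec ℕ n) {r} → IsPartition n v → 1 ≤ r → r ≤ suc n →
                   (∀ k → 1 ≤ k → suc k ≡ r → at v r < at v k) → IsPartition (suc n) (down v r)
down-isPartition v {r} (anti , sum≡) r≥1 r≤n+1 room =
  incr-nonIncreasing (v ∷ʳ 0) anti′ r≥1 r≤n+1 room′ ,
  trans (sum-incr (v ∷ʳ 0) r≥1 r≤n+1) (cong suc (trans (sum-∷ʳ0 v) sum≡))
  where
  anti′ : NonIncreasing (v ∷ʳ 0)
  anti′ k k≥1 = subst₂ _≤_ (sym (at-∷ʳ0 v (suc k))) (sym (at-∷ʳ0 v k)) (anti k k≥1)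
  room′ : ∀ k → 1 ≤ k → suc k ≡ r → at (v ∷ʳ 0) r < at (v ∷ʳ 0) k
  room′ k k≥1 e = subst₂ _<_ (sym (at-∷ʳ0 v r)) (sym (at-∷ʳ0 v k)) (room k k≥1 e)

d-flat : ∀ {n} (v : Vec ℕ n) {i} → at v (suc i) ≡ at v i → d v i ≡ 0
d-flat v {i} e = trans (cong (at v i ∸_) e) (n∸n≡0 (at v i))

d-slip : ∀ {n} (v : Vec ℕ n) {i} → at v i ≡ suc (at v (suc i)) → d v i ≡ 1
d-slip v {i} e = trans (cong (_∸ at v (suc i)) e) (m+n∸n≡m 1 (at v (suc i)))

constant⇒d≡0 : ∀ {n} (v : Vec ℕ n) {a b c} → (∀ m → a ≤ m → m ≤ b → at v m ≡ c) →
               ∀ i → a ≤ i → i < b → d v i ≡ 0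
constant⇒d≡0 v const i a≤i i<b =
  d-flat v (trans (const (suc i) (≤-trans a≤i (n≤1+n i)) i<b) (sym (const i a≤i (<⇒≤ i<b))))

d-cliff : ∀ {n} (v : Vec ℕ n) {i} → 2 + at v (suc i) ≤ at v i → Cliff v i
d-cliff v {i} cliff = subst (_≤ d v i) (m+n∸n≡m 2 (at v (suc i))) (∸-monoˡ-≤ (at v (suc i)) cliff)

at-ones-< : ∀ {m i} → i < m → at (replicate m 1 ∷ʳ 0) (suc i) ≡ 1
at-ones-< {suc m} {zero}  _       = refl
at-ones-< {suc m} {suc i} (s≤s p) = at-ones-< p

at-ones-≥ : ∀ {m i} → m ≤ i → at (replicate m 1 ∷ʳ 0) (suc i) ≡ 0
at-ones-≥ {zero}  {zero}  _       = refl
at-ones-≥ {zero}  {suc i} _       = refl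
at-ones-≥ {suc m} {suc i} (s≤s p) = at-ones-≥ p

sum-ones : ∀ m → sum (replicate m 1 ∷ʳ 0) ≡ m
sum-ones zero    = refl
sum-ones (suc m) = cong suc (sum-ones m)

-- Antitone functions and plateaus

-- NonIncreasing v unfolds to Antitone (at v).
Antitone : (ℕ → ℕ) → Set
Antitone f = ∀ i → 1 ≤ i → f (suc i) ≤ f i

antitone-≤ : ∀ {f} → Antitone f → ∀ {i k} → 1 ≤ i → i ≤ k → f k ≤ f i
antitone-≤ anti {k = zero}  i≥1 i≤k = ⊥-elim (1+n≰n (≤-trans i≥1 i≤k))
antitone-≤ anti {k = suc k} i≥1 i≤k with m≤n⇒m<n∨m≡n i≤k
... | inj₂ refl      = ≤-refl
... | inj₁ (s≤s i≤k′) = ≤-trans (anti k (≤-trans i≥1 i≤k′)) (antitone-≤ anti i≥1 i≤k′)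

Holds-on : (ℕ → Set) → ℕ → ℕ → Set
Holds-on P a q = ∀ m → a ≤ m → m ≤ q → P m

holds-or-fails : ∀ {P : ℕ → Set} → Decidable P → ∀ {a} → P a → ∀ b →
                 Holds-on P a b ⊎ Σ ℕ λ q → a ≤ q × q < b × Holds-on P a q × ¬ P (suc q)
holds-or-fails {P} dec {a} Pa zero = inj₁ λ m a≤m m≤0 → subst P (≤-antisym a≤m (≤-trans m≤0 z≤n)) Pa
holds-or-fails {P} dec {a} Pa (suc b) with holds-or-fails dec Pa b
... | inj₂ (q , a≤q , q<b , on , ¬Pq) = inj₂ (q , a≤q , ≤-trans q<b (n≤1+n b) , on , ¬Pq)
... | inj₁ on with dec (suc b)
...   | yes Pb = inj₁ λ m a≤m m≤b →
  [ (λ m<b → on m a≤m (≤-pred m<b)) , (λ { refl → Pb }) ]′ (m≤n⇒m<n∨m≡n m≤b)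
...   | no ¬Pb with a ≤? b
...     | yes a≤b = inj₂ (b , a≤b , ≤-refl , on , ¬Pb)
...     | no a≰b  = inj₁ λ m a≤m m≤b → subst P (≤-antisym a≤m (≤-trans m≤b (≰⇒> a≰b))) Pa

first-failure : ∀ {P : ℕ → Set} → Decidable P → ∀ {a b} → P a → ¬ Holds-on P a b →
                Σ ℕ λ q → a ≤ q × q < b × Holds-on P a q × ¬ P (suc q)
first-failure dec {b = b} Pa ¬on = [ ⊥-elim ∘ ¬on , id ]′ (holds-or-fails dec Pa b)

Plateau : (ℕ → ℕ) → ℕ → ℕ → Set
Plateau f p q = Holds-on (λ m → f m ≡ f p) p q

plateau-end-before : ∀ {f} → Antitone f → ∀ {p b} → 1 ≤ p → p ≤ b → f b < f p →
                     Σ ℕ λ q → p ≤ q × q < b × Plateau f p q × f (suc q) < f p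
plateau-end-before {f} anti {p} p≥1 p≤b fb<fp
  with first-failure (λ m → f m ≟ f p) refl (λ on → <-irrefl (on _ p≤b ≤-refl) fb<fp)
... | q , p≤q , q<b , on , ne = q , p≤q , q<b , on ,
  ≤∧≢⇒< (≤-trans (anti q (≤-trans p≥1 p≤q)) (≤-reflexive (on q p≤q ≤-refl))) ne

plateau-end : ∀ {n} (v : Vec ℕ n) → NonIncreasing v → ∀ {p} → 1 ≤ p → 1 ≤ at v p →
              Σ ℕ λ q → p ≤ q × Plateau (at v) p q × at v (suc q) < at v p
plateau-end {n} v anti {p} p≥1 vp≥1
  with plateau-end-before anti p≥1 (m≤n+m p (suc n))
         (subst (_< at v p) (sym (at-out v (s≤s (m≤m+n n p)))) vp≥1)
... | q , p≤q , _ , on , drop = q , p≤q , on , drop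

plateau-point : ∀ {f p} → Plateau f p p
plateau-point {f} m p≤m m≤p = cong f (≤-antisym m≤p p≤m)

-- Brylawski's moves

record Move (f : ℕ → ℕ) (i j : ℕ) : Set where
  field
    start≥1 : 1 ≤ i
    start<target : i < j
    gap : 2 + f j ≤ f i
    inner : ∀ k → i < k → k < j → suc (f k) ≡ f i × f k ≡ suc (f j)
open Move public

Move-start≥2 : ∀ {f i j} → Move f i j → 2 ≤ f i
Move-start≥2 M = ≤-trans (m≤m+n 2 _) (gap M)

Move-descent : ∀ {f i j} → Move f i j → f (suc i) < f i
Move-descent {f} {i} {j} M with m≤n⇒m<n∨m≡n (start<target M)
... | inj₂ refl = ≤-trans (s≤s (n≤1+n _)) (gap M)
... | inj₁ lt   = ≤-reflexive (proj₁ (inner M (suc i) ≤-refl lt))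

Move-transport : ∀ {f g i j} → (∀ k → i ≤ k → k ≤ j → g k ≡ f k) → Move f i j → Move g i j
Move-transport {f} {g} {i} {j} g≡f M = record
  { start≥1      = start≥1 M
  ; start<target = i<j
  ; gap          = subst₂ (λ x y → 2 + x ≤ y) (sym gj) (sym gi) (gap M)
  ; inner        = λ k i<k k<j → let gk = g≡f k (<⇒≤ i<k) (<⇒≤ k<j) ; (e₁ , e₂) = inner M k i<k k<j in
                     trans (cong suc gk) (trans e₁ (sym gi)) , trans gk (trans e₂ (cong suc (sym gj)))
  }
  where
  i<j : i < j
  i<j = start<target M
  gi : g i ≡ f i
  gi = g≡f i ≤-refl (<⇒≤ i<j)
  gj : g j ≡ f j
  gj = g≡f j (<⇒≤ i<j) ≤-refl

cliff-move : ∀ {f i} → 1 ≤ i → 2 + f (suc i) ≤ f i → Move f i (suc i)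
cliff-move i≥1 cliff = record
  { start≥1 = i≥1 ; start<target = ≤-refl ; gap = cliff
  ; inner = λ k i<k k<i+1 → ⊥-elim (1+n≰n (≤-trans k<i+1 i<k)) }

move-over-plateau : ∀ {f i q c} → 1 ≤ i → i ≤ q → f i ≡ suc c → (∀ m → i < m → m ≤ q → f m ≡ c) →
                    c ≡ suc (f (suc q)) → Move f i (suc q)
move-over-plateau {f} {i} {q} {c} i≥1 i≤q fi plateau c≡ = record
  { start≥1 = i≥1 ; start<target = s≤s i≤q
  ; gap = ≤-reflexive (sym (trans fi (cong suc c≡)))
  ; inner = λ k i<k k≤q → let fk = plateau k i<k (≤-pred k≤q) in
              trans (cong suc fk) (sym fi) , trans fk c≡ }

Move-target-unique : ∀ {f i j j′} → Move f i j → Move f i j′ → j ≡ j′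
Move-target-unique {f} {i} {j} {j′} M M′ with <-cmp j j′
... | tri≈ _ e _ = e
... | tri< j<j′ _ _ = ⊥-elim (1+n≰n (≤-trans (gap M) (≤-reflexive (sym (proj₁ (inner M′ j (start<target M) j<j′))))))
... | tri> _ _ j′<j = ⊥-elim (1+n≰n (≤-trans (gap M′) (≤-reflexive (sym (proj₁ (inner M j′ (start<target M′) j′<j))))))

Move-nested : ∀ {f i j i′ j′} → Antitone f → Move f i j → Move f i′ j′ → i ≤ i′ → j′ ≤ j →
              i ≡ i′ × j ≡ j′
Move-nested {f} {i} {j} {i′} {j′} anti M M′ i≤i′ j′≤j with m≤n⇒m<n∨m≡n i≤i′
... | inj₂ refl    = refl , Move-target-unique M M′
... | inj₁ i<i′ = ⊥-elim (1+n≰n (begin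
  2 + f j   ≤⟨ s≤s (s≤s (antitone-≤ anti (≤-trans (start≥1 M′) (<⇒≤ (start<target M′))) j′≤j)) ⟩
  2 + f j′  ≤⟨ gap M′ ⟩
  f i′      ≡⟨ proj₂ (inner M i′ i<i′ (<-≤-trans (start<target M′) j′≤j)) ⟩
  suc (f j) ∎))
  where open ≤-Reasoning

MoveWithin : (ℕ → ℕ) → ℕ → ℕ → Set
MoveWithin f s j = Σ ℕ λ i′ → Σ ℕ λ j′ → s ≤ i′ × j′ ≤ j × Move f i′ j′

-- Either a cliff follows s, or the gap already holds from s + 1, or f s = f j + 2 and
-- f (s + 1) = f j + 1, and the plateau from s + 1 ends right before a value f j.
private
  move-between′ : ∀ {f} → Antitone f → ∀ d {s} → 1 ≤ s → 2 + f (d + suc s) ≤ f s → MoveWithin f s (d + suc s)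
  move-between′ {f} anti d {s} s≥1 gp with 2 + f (suc s) ≤? f s
  ... | yes cliff = s , suc s , ≤-refl , m≤n+m (suc s) d , cliff-move s≥1 cliff
  move-between′ {f} anti zero    {s} s≥1 gp | no ¬cliff = ⊥-elim (¬cliff gp)
  move-between′ {f} anti (suc d) {s} s≥1 gp | no ¬cliff with 2 + f j ≤? f (suc s)
    where
    j : ℕ
    j = suc d + suc s
  ... | yes gp′ with move-between′ anti d (s≤s z≤n) (subst (λ x → 2 + f x ≤ f (suc s)) (sym (+-suc d (suc s))) gp′)
  ...   | i′ , j′ , s<i′ , j′≤ , M = i′ , j′ , <⇒≤ s<i′ , ≤-trans j′≤ (≤-reflexive (+-suc d (suc s))) , M
  move-between′ {f} anti (suc d) {s} s≥1 gp | no ¬cliff | no ¬gp′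
    with plateau-end-before anti (s≤s z≤n) (m≤n+m (suc s) (suc d)) fj<c
    where
    j : ℕ
    j = suc d + suc s
    fj<c : f j < f (suc s)
    fj<c = ≤-pred (≤-trans gp (≤-pred (≰⇒> ¬cliff)))
  ... | q , s<q , q<j , plateau , drop = s , suc q , ≤-refl , q<j , move-over-plateau s≥1 (<⇒≤ s<q) fs plateau c≡
    where
    c = f (suc s)
    fs : f s ≡ suc c
    fs = ≤-antisym (≤-pred (≰⇒> ¬cliff)) (≤-trans (s≤s (≤-pred (≰⇒> ¬gp′))) gp)
    c≡ : c ≡ suc (f (suc q))
    c≡ = ≤-antisym (≤-trans (≤-pred (≰⇒> ¬gp′)) (s≤s (antitone-≤ anti (s≤s z≤n) q<j))) drop

move-between : ∀ {f} → Antitone f → ∀ {s j} → 1 ≤ s → s < j → 2 + f j ≤ f s → MoveWithin f s j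
move-between {f} anti {s} {j} s≥1 s<j gp =
  subst (MoveWithin f s) j≡ (move-between′ anti (j ∸ suc s) s≥1 (subst (λ x → 2 + f x ≤ f s) (sym j≡) gp))
  where
  j≡ : j ∸ suc s + suc s ≡ j
  j≡ = m∸n+n≡m s<j

move-at-or-after : ∀ {n} (v : Vec ℕ n) → NonIncreasing v → ∀ {p} → 1 ≤ p → 2 ≤ at v p →
                   Σ ℕ λ i → Σ ℕ λ j → p ≤ i × Move (at v) i j
move-at-or-after {n} v anti {p} p≥1 vp≥2
  with move-between anti p≥1 (s≤s (m≤n+m p n))
         (subst (λ x → 2 + x ≤ at v p) (sym (at-out v (s≤s (m≤m+n n p)))) vp≥2)
... | i , j , p≤i , _ , M = i , j , p≤i , M

no-move-before-cliffed-plateau : ∀ {f i q c j} → i < q → f i ≡ suc c → (∀ m → i < m → m ≤ q → f m ≡ c) →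
                                 2 + f (suc q) ≤ c → ¬ Move f i j
no-move-before-cliffed-plateau {f} {i} {q} {c} {j} i<q fi plateau cliff M with m≤n⇒m<n∨m≡n (start<target M)
... | inj₂ refl = 1+n≰n (≤-trans (subst (λ x → 2 + x ≤ f i) (plateau (suc i) ≤-refl i<q) (gap M)) (≤-reflexive fi))
... | inj₁ i+1<j = beyond (<-cmp j (suc q))
  where
  c≡ : c ≡ suc (f j)
  c≡ = trans (sym (plateau (suc i) ≤-refl i<q)) (proj₂ (inner M (suc i) ≤-refl i+1<j))
  beyond : Tri (j < suc q) (j ≡ suc q) (suc q < j) → ⊥
  beyond (tri< j≤q _ _)   = 1+n≰n (≤-reflexive (trans (cong suc (sym (plateau j (start<target M) (≤-pred j≤q)))) (sym c≡)))
  beyond (tri≈ _ refl _)  = 1+n≰n (≤-trans (≤-reflexive (cong suc c≡)) cliff)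
  beyond (tri> _ _ q+1<j) = 1+n≰n (≤-trans (n≤1+n (suc c)) (subst (λ x → 2 + x ≤ c) fq+1≡c cliff))
    where
    fq+1≡c : f (suc q) ≡ c
    fq+1≡c = trans (proj₂ (inner M (suc q) (<-trans i<q ≤-refl) q+1<j)) (sym c≡)

-- Covers and join-irreducible partitions

move : ∀ {n} → Vec ℕ n → ℕ → ℕ → Vec ℕ n
move v i j = incr (decr v i) j

module _ {n} (v : Vec ℕ n) {i j} (M : Move (at v) i j) (j≤n : j ≤ n) where
  private
    i<j : i < j
    i<j = start<target M
    j≥1 : 1 ≤ j
    j≥1 = ≤-trans (start≥1 M) (<⇒≤ i<j)
    vi≥1 : 1 ≤ at v i
    vi≥1 = ≤-trans (s≤s z≤n) (Move-start≥2 M)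

  psum-move-< : ∀ {m} → m < i → psum (move v i j) m ≡ psum v m
  psum-move-< m<i = trans (psum-incr-< (decr v i) (<-trans m<i i<j)) (psum-decr-< v m<i)

  psum-move-inside : ∀ {m} → i ≤ m → m < j → suc (psum (move v i j) m) ≡ psum v m
  psum-move-inside i≤m m<j = trans (cong suc (psum-incr-< (decr v i) m<j)) (psum-decr-≥ v (start≥1 M) vi≥1 i≤m)

  psum-move-≥ : ∀ {m} → j ≤ m → psum (move v i j) m ≡ psum v m
  psum-move-≥ j≤m = trans (psum-incr-≥ (decr v i) j≥1 j≤n j≤m)
                          (psum-decr-≥ v (start≥1 M) vi≥1 (≤-trans (<⇒≤ i<j) j≤m))

  move-isPartition : IsPartition n v → IsPartition n (move v i j)
  move-isPartition (anti , sum≡) =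
    incr-nonIncreasing (decr v i) (decr-nonIncreasing v anti (Move-descent M)) j≥1 j≤n room ,
    trans (sum-incr (decr v i) j≥1 j≤n) (trans (sum-decr v (start≥1 M) vi≥1) sum≡)
    where
    vj : at (decr v i) j ≡ at v j
    vj = at-decr-≢ v (λ e → <⇒≢ i<j (sym e))
    room : ∀ k → 1 ≤ k → suc k ≡ j → at (decr v i) j < at (decr v i) k
    room k _ refl with k ≟ i
    ... | yes refl = subst₂ _<_ (sym vj) (sym (at-decr-≡ v k)) (pred-mono-≤ (gap M))
    ... | no k≢i   = subst₂ _<_ (sym vj) (sym (at-decr-≢ v k≢i))
                       (≤-reflexive (sym (proj₂ (inner M k (≤∧≢⇒< (≤-pred i<j) (λ e → k≢i (sym e))) ≤-refl))))

  psum-move-≤ : ∀ m → psum (move v i j) m ≤ psum v m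
  psum-move-≤ m with m <? i | m <? j
  ... | yes m<i | _       = ≤-reflexive (psum-move-< m<i)
  ... | no m≮i  | yes m<j = ≤-trans (n≤1+n _) (≤-reflexive (psum-move-inside (≮⇒≥ m≮i) m<j))
  ... | no _    | no m≮j  = ≤-reflexive (psum-move-≥ (≮⇒≥ m≮j))

  move-◁ : move v i j ◁ v
  move-◁ = psum-move-≤ , λ e → 1+n≰n (≤-reflexive (trans (psum-move-inside ≤-refl i<j) (cong (λ w → psum w i) (sym e))))

  ⊴-move : ∀ {β} → β ⊴ v → (∀ m → i ≤ m → m < j → psum β m < psum v m) → β ⊴ move v i j
  ⊴-move {β} β⊴v strict m with m <? i | m <? j
  ... | yes m<i | _       = ≤-trans (β⊴v m) (≤-reflexive (sym (psum-move-< m<i)))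
  ... | no m≮i  | yes m<j =
    ≤-pred (≤-trans (strict m (≮⇒≥ m≮i) m<j) (≤-reflexive (sym (psum-move-inside (≮⇒≥ m≮i) m<j))))
  ... | no _    | no m≮j  = ≤-trans (β⊴v m) (≤-reflexive (sym (psum-move-≥ (≮⇒≥ m≮j))))

⊴-antisym : ∀ {n} {α β : Vec ℕ n} → β ⊴ α → α ⊴ β → β ≡ α
⊴-antisym {α = α} {β} β⊴α α⊴β = psum-injective β α λ m → ≤-antisym (β⊴α m) (α⊴β m)

BelowAlongMove : ∀ {n} → Vec ℕ n → Vec ℕ n → Set
BelowAlongMove {n} β α =
  Σ ℕ λ i → Σ ℕ λ j → Move (at α) i j × j ≤ n × (∀ m → i ≤ m → m < j → psum β m < psum α m)

module _ {n} (α β : Vec ℕ n) (Pα : IsPartition n α) (Pβ : IsPartition n β) (β◁α : β ◁ α) where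
  private
    f g : ℕ → ℕ
    f = at α
    g = at β

    Agree Strict : ℕ → Set
    Agree m = psum β m ≡ psum α m
    Strict m = psum β m < psum α m

    agree-beyond : ∀ m → n ≤ m → Agree m
    agree-beyond m n≤m = trans (psum-sum β n≤m) (trans (proj₂ Pβ) (sym (trans (psum-sum α n≤m) (proj₂ Pα))))

    first-disagreement : Σ ℕ λ i₀ → i₀ < n × Agree i₀ × Strict (suc i₀)
    first-disagreement with first-failure (λ m → psum β m ≟ psum α m) refl ¬agree
      where
      ¬agree : ¬ Holds-on Agree 0 n
      ¬agree on = proj₂ β◁α (psum-injective β α λ m →
        [ (λ m≤n → on m z≤n m≤n) , (λ n<m → agree-beyond m (<⇒≤ n<m)) ]′ (≤-<-connex m n))
    ... | i₀ , _ , i₀<n , agree , ne = i₀ , i₀<n , agree i₀ z≤n ≤-refl , ≤∧≢⇒< (proj₁ β◁α (suc i₀)) ne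

    strict-stretch : Σ ℕ λ s → Σ ℕ λ q →
                       1 ≤ s × s ≤ q × q < n × g s < f s × Holds-on Strict s q × f (suc q) < g (suc q)
    strict-stretch with first-disagreement
    ... | i₀ , i₀<n , agree , strict-s
      with first-failure (λ m → psum β m <? psum α m) strict-s (λ on → <-irrefl (agree-beyond n ≤-refl) (on n i₀<n ≤-refl))
    ...   | q , s≤q , q<n , strict , ¬strict = suc i₀ , q , s≤s z≤n , s≤q , q<n , gs<fs , strict , fj<gj
      where
      gs<fs : g (suc i₀) < f (suc i₀)
      gs<fs = +-cancelˡ-< (psum α i₀) _ _ (subst (λ x → x + g (suc i₀) < psum α (suc i₀)) agree strict-s)
      fj<gj : f (suc q) < g (suc q)
      fj<gj with g (suc q) ≤? f (suc q)
      ... | yes g≤f = ⊥-elim (¬strict (+-mono-<-≤ (strict q s≤q ≤-refl) g≤f))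
      ... | no g≰f  = ≰⇒> g≰f

  -- With s the first index where the partial sums differ and q + 1 the next one where they
  -- agree again, a_s > b_s ≥ b_{q+1} > a_{q+1}, so α drops by at least 2 between s and q + 1.
  below-move : BelowAlongMove β α
  below-move with strict-stretch
  ... | s , q , s≥1 , s≤q , q<n , gs<fs , strict , fj<gj
    with move-between (proj₁ Pα) s≥1 (s≤s s≤q)
           (≤-trans (s≤s (≤-trans fj<gj (antitone-≤ (proj₁ Pβ) s≥1 (≤-trans s≤q (n≤1+n q))))) gs<fs)
  ...   | i , j , s≤i , j≤q+1 , M = i , j , M , ≤-trans j≤q+1 q<n ,
          λ m i≤m m<j → strict m (≤-trans s≤i i≤m) (≤-pred (<-≤-trans m<j j≤q+1))

move-covers : ∀ {n} (v : Vec ℕ n) {i j} → IsPartition n v → (M : Move (at v) i j) → (j≤n : j ≤ n) →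
              Covers n v (move v i j)
move-covers {n} v {i} {j} Pv M j≤n = move-isPartition v M j≤n Pv , move-◁ v M j≤n , no-middle
  where
  γ : Vec ℕ n
  γ = move v i j
  no-middle : ¬ (Σ (Vec ℕ n) λ δ → IsPartition n δ × γ ◁ δ × δ ◁ v)
  no-middle (δ , Pδ , (γ⊴δ , γ≢δ) , δ◁v) = γ≢δ (sym (⊴-antisym (squeeze (below-move v δ Pv Pδ δ◁v)) γ⊴δ))
    where
    squeeze : BelowAlongMove δ v → δ ⊴ γ
    squeeze (i′ , j′ , M′ , _ , below) = ⊴-move v M j≤n (proj₁ δ◁v) inside-strict
      where
      inside : ∀ m → i′ ≤ m → m < j′ → i ≤ m × m < j
      inside m i′≤m m<j′ with m <? i | m <? j
      ... | yes m<i | _       = ⊥-elim (<-irrefl (psum-move-< v M j≤n m<i) (≤-<-trans (γ⊴δ m) (below m i′≤m m<j′)))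
      ... | no m≮i  | yes m<j = ≮⇒≥ m≮i , m<j
      ... | no _    | no m≮j  =
        ⊥-elim (<-irrefl (psum-move-≥ v M j≤n (≮⇒≥ m≮j)) (≤-<-trans (γ⊴δ m) (below m i′≤m m<j′)))
      i′-inside : i ≤ i′ × i′ < j
      i′-inside = inside i′ ≤-refl (start<target M′)
      same : i ≡ i′ × j ≡ j′
      same = Move-nested (proj₁ Pv) M M′ (proj₁ i′-inside)
                         (≮⇒≥ λ j<j′ → <-irrefl refl (proj₂ (inside j (<⇒≤ (proj₂ i′-inside)) j<j′)))
      inside-strict : ∀ m → i ≤ m → m < j → psum δ m < psum v m
      inside-strict m i≤m m<j = below m (subst (_≤ m) (proj₁ same) i≤m) (subst (m <_) (proj₂ same) m<j)

covers⇒move : ∀ {n} (v γ : Vec ℕ n) → IsPartition n v → Covers n v γ →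
              Σ ℕ λ i → Σ ℕ λ j → Move (at v) i j × j ≤ n × γ ≡ move v i j
covers⇒move {n} v γ Pv (Pγ , γ◁v , no-middle) = pick (below-move v γ Pv Pγ γ◁v)
  where
  pick : BelowAlongMove γ v → Σ ℕ λ i → Σ ℕ λ j → Move (at v) i j × j ≤ n × γ ≡ move v i j
  pick (i , j , M , j≤n , below) = i , j , M , j≤n , decidable-stable (≡-dec _≟_ γ (move v i j)) λ γ≢ →
    no-middle (move v i j , move-isPartition v M j≤n Pv , (⊴-move v M j≤n (proj₁ γ◁v) below , γ≢) , move-◁ v M j≤n)

private
  earlier-move-differs : ∀ {n} (v : Vec ℕ n) {i j i′ j′} (M : Move (at v) i j) (j≤n : j ≤ n)
                         (M′ : Move (at v) i′ j′) (j′≤n : j′ ≤ n) → i < i′ → move v i j ≢ move v i′ j′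
  earlier-move-differs v {i} {j} {i′} {j′} M j≤n M′ j′≤n i<i′ e = 1+n≰n (≤-reflexive (begin
    suc (psum v i)              ≡⟨ cong suc (psum-move-< v M′ j′≤n i<i′) ⟨
    suc (psum (move v i′ j′) i) ≡⟨ cong (λ w → suc (psum w i)) e ⟨
    suc (psum (move v i j) i)   ≡⟨ psum-move-inside v M j≤n ≤-refl (start<target M) ⟩
    psum v i                    ∎))
    where open ≡-Reasoning

move-start-injective : ∀ {n} (v : Vec ℕ n) {i j i′ j′} (M : Move (at v) i j) (j≤n : j ≤ n)
                       (M′ : Move (at v) i′ j′) (j′≤n : j′ ≤ n) → move v i j ≡ move v i′ j′ → i ≡ i′
move-start-injective v {i} {j} {i′} {j′} M j≤n M′ j′≤n e with <-cmp i i′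
... | tri≈ _ i≡i′ _ = i≡i′
... | tri< i<i′ _ _ = ⊥-elim (earlier-move-differs v M j≤n M′ j′≤n i<i′ e)
... | tri> _ _ i′<i = ⊥-elim (earlier-move-differs v M′ j′≤n M j≤n i′<i (sym e))

psum-lower-bound : ∀ {n} (v : Vec ℕ n) → NonIncreasing v → 2 ≤ at v 1 →
                   ∀ m → 1 ≤ at v (suc m) → 2 + m ≤ psum v (suc m)
psum-lower-bound v anti v1≥2 zero    _      = v1≥2
psum-lower-bound v anti v1≥2 (suc m) vm+2≥1 = subst (_≤ psum v (suc m) + at v (suc (suc m))) (+-comm (2 + m) 1)
  (+-mono-≤ (psum-lower-bound v anti v1≥2 m (≤-trans vm+2≥1 (anti (suc m) (s≤s z≤n)))) vm+2≥1)

move-target-≤ : ∀ {n} (v : Vec ℕ n) {i j} → IsPartition n v → Move (at v) i j → j ≤ n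
move-target-≤ v {i} {zero}        _              M = ⊥-elim (1+n≰n (≤-trans (start<target M) z≤n))
move-target-≤ v {i} {suc zero}    _              M = ⊥-elim (1+n≰n (≤-trans (start≥1 M) (≤-pred (start<target M))))
move-target-≤ v {i} {suc (suc j)} (anti , sum≡) M =
  ≤-trans (psum-lower-bound v anti v1≥2 j vj+1≥1) (≤-trans (psum-≤-sum v (suc j)) (≤-reflexive sum≡))
  where
  v1≥2 : 2 ≤ at v 1
  v1≥2 = ≤-trans (Move-start≥2 M) (antitone-≤ anti ≤-refl (start≥1 M))
  vj+1≥1 : 1 ≤ at v (suc j)
  vj+1≥1 with m≤n⇒m<n∨m≡n (≤-pred (start<target M))
  ... | inj₂ refl = ≤-trans (s≤s z≤n) (Move-start≥2 M)
  ... | inj₁ i<j+1 = ≤-trans (s≤s z≤n) (≤-reflexive (sym (proj₂ (inner M (suc j) i<j+1 ≤-refl))))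

unique-move⇒joinIrr : ∀ {n} (S : Vec ℕ n) {i j} → IsPartition n S → Move (at S) i j →
                      (∀ i′ j′ → Move (at S) i′ j′ → i′ ≡ i) → JoinIrr n S
unique-move⇒joinIrr {n} S {i} {j} P M unique =
  P , move S i j , move-covers S P M (move-target-≤ S P M) , λ γ cov → only (covers⇒move S γ P cov)
  where
  only : ∀ {γ} → (Σ ℕ λ i′ → Σ ℕ λ j′ → Move (at S) i′ j′ × j′ ≤ n × γ ≡ move S i′ j′) → γ ≡ move S i j
  only (i′ , j′ , M′ , _ , refl) with unique i′ j′ M′
  ... | refl = cong (move S i) (sym (Move-target-unique M M′))

joinIrr⇒move : ∀ {n} (S : Vec ℕ n) → JoinIrr n S → Σ ℕ λ i → Σ ℕ λ j → Move (at S) i j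
joinIrr⇒move S (P , β , cov , _) = let (i , j , M , _) = covers⇒move S β P cov in i , j , M

joinIrr⇒unique-start : ∀ {n} (S : Vec ℕ n) {i j i′ j′} → JoinIrr n S →
                       Move (at S) i j → Move (at S) i′ j′ → i ≡ i′
joinIrr⇒unique-start S (P , β , _ , only) M M′ =
  move-start-injective S M (move-target-≤ S P M) M′ (move-target-≤ S P M′)
    (trans (only _ (move-covers S P M (move-target-≤ S P M))) (sym (only _ (move-covers S P M′ (move-target-≤ S P M′)))))

joinIrr-if-small-after-plateau : ∀ {n} (v : Vec ℕ n) {p} → IsPartition n v → 1 ≤ p → 2 ≤ at v p →
                                 Plateau (at v) 1 p → (∀ m → p < m → at v m ≤ 1) → JoinIrr n v
joinIrr-if-small-after-plateau v {p} P p≥1 vp≥2 plateau small =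
  let (i , j , _ , M) = move-at-or-after v (proj₁ P) p≥1 vp≥2
  in unique-move⇒joinIrr v P M λ i′ j′ M′ → trans (starts-at-p M′) (sym (starts-at-p M))
  where
  starts-at-p : ∀ {i j} → Move (at v) i j → i ≡ p
  starts-at-p {i} M with <-cmp i p
  ... | tri≈ _ i≡p _ = i≡p
  ... | tri< i<p _ _ = ⊥-elim (<-irrefl (trans (plateau (suc i) (s≤s z≤n) i<p) (sym (plateau i (start≥1 M) (<⇒≤ i<p))))
                                        (Move-descent M))
  ... | tri> _ _ p<i = ⊥-elim (1+n≰n (≤-trans (Move-start≥2 M) (small i p<i)))

-- Right sons

step-rightSon : ∀ {n} (α : Vec ℕ n) {c q} → IsPartition n α → at α 1 ≡ suc c → 2 ≤ q →
                (∀ m → 2 ≤ m → m ≤ q → at α m ≡ c) → 2 + at α (suc q) ≤ c ⊎ c ≡ suc (at α (suc q)) →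
                RightSon n α (down α 2)
step-rightSon {n} α {c} {suc q} P α₁ q+1≥2 plateau end = inj₁ (step end , refl)
  where
  D : Vec ℕ n
  D = decr α 1
  D-plateau : ∀ m → 1 ≤ m → m ≤ suc q → at D m ≡ c
  D-plateau (suc zero)    _ _   = trans (at-decr-≡ α 1) (cong pred α₁)
  D-plateau (suc (suc m)) _ m≤q = trans (at-decr-≢ α (λ ())) (plateau (suc (suc m)) (s≤s (s≤s z≤n)) m≤q)
  D-after : at D (suc (suc q)) ≡ at α (suc (suc q))
  D-after = at-decr-≢ α (λ ())
  D-anti : NonIncreasing D
  D-anti = decr-nonIncreasing α (proj₁ P) (subst₂ _<_ (sym (plateau 2 ≤-refl q+1≥2)) (sym α₁) ≤-refl)
  flat : ∀ i → 1 ≤ i → i < suc q → d D i ≡ 0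
  flat = constant⇒d≡0 D D-plateau
  top≥1 : 1 ≤ at α 1
  top≥1 = subst (1 ≤_) (sym α₁) (s≤s z≤n)
  step : 2 + at α (suc (suc q)) ≤ c ⊎ c ≡ suc (at α (suc (suc q))) → Ss _ α ⊎ NS _ α
  step (inj₁ cliff) = inj₂ (P , top≥1 , D-anti , suc q , q+1≥2 , flat ,
                            d-cliff D (subst₂ (λ x y → 2 + x ≤ y) (sym D-after)
                                                  (sym (D-plateau (suc q) (s≤s z≤n) ≤-refl)) cliff))
  step (inj₂ slip)  = inj₁ (P , top≥1 , D-anti , q , ≤-pred q+1≥2 , flat ,
                            d-slip D (trans (D-plateau (suc q) (s≤s z≤n) ≤-refl) (trans slip (cong suc (sym D-after)))))

plateau-rightSon : ∀ {n} (α : Vec ℕ n) {k} → IsPartition n α → 2 ≤ k → Plateau (at α) 1 k →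
                   at α k ≡ suc (at α (suc k)) → RightSon n α (down α (suc k))
plateau-rightSon α {suc l} P k≥2 plateau slip =
  inj₂ (l , ≤-pred k≥2 , (P , ≤-pred k≥2 , constant⇒d≡0 α plateau , d-slip α slip) , cong (down α) (+-comm 2 l))

flat-cliff-not-slip : ∀ {n} (v : Vec ℕ n) {x y} → (∀ i → 1 ≤ i → i < x → d v i ≡ 0) → Cliff v x →
                      (∀ i → 1 ≤ i → i < y → d v i ≡ 0) → d v y ≡ 1 → 1 ≤ x → 1 ≤ y → ⊥
flat-cliff-not-slip v {x} {y} flat-x cliff flat-y slip x≥1 y≥1 with <-cmp x y
... | tri< x<y _ _ = 1+n≰n (≤-trans (s≤s z≤n) (≤-trans cliff (≤-reflexive (flat-y x x≥1 x<y))))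
... | tri≈ _ refl _ = 1+n≰n (≤-trans cliff (≤-reflexive slip))
... | tri> _ _ y<x = 0≢1+n (trans (sym (flat-x y y≥1 y<x)) slip)

step⇒second≡pred-first : ∀ {n} (α : Vec ℕ n) → NonIncreasing (decr α 1) → d (decr α 1) 1 ≡ 0 → at α 2 ≡ pred (at α 1)
step⇒second≡pred-first α D-anti flat = ≤-antisym
  (subst₂ _≤_ (at-decr-≢ α (λ ())) (at-decr-≡ α 1) (D-anti 1 ≤-refl))
  (subst₂ _≤_ (at-decr-≡ α 1) (at-decr-≢ α (λ ())) (m∸n≡0⇒m≤n flat))

private
  second-after-cliffed-plateau : ∀ {n} (α : Vec ℕ n) {k} → 1 ≤ k → Plateau (at α) 1 k → 2 + at α (suc k) ≤ at α 1 →
                                 at α 2 ≢ pred (at α 1)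
  second-after-cliffed-plateau α {k} k≥1 plateau cliff second with at α 1 | m≤n⇒m<n∨m≡n k≥1
  ... | suc a | inj₂ refl = 1+n≰n (subst (λ x → 2 + x ≤ suc a) second cliff)
  ... | suc a | inj₁ 1<k  = 1+n≰n (≤-reflexive (trans (sym (plateau 2 (s≤s z≤n) 1<k)) second))
  ... | zero  | _         = 1+n≰n (≤-trans (s≤s z≤n) cliff)

no-rightSon : ∀ {n} (α : Vec ℕ n) {k β} → 1 ≤ k → Plateau (at α) 1 k → 2 + at α (suc k) ≤ at α 1 → ¬ RightSon n α β
no-rightSon α k≥1 plateau cliff (inj₁ (inj₁ (_ , _ , D-anti , l , l≥1 , D-flat , _) , _)) =
  second-after-cliffed-plateau α k≥1 plateau cliff (step⇒second≡pred-first α D-anti (D-flat 1 ≤-refl (s≤s l≥1)))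
no-rightSon α k≥1 plateau cliff (inj₁ (inj₂ (_ , _ , D-anti , k′ , 1<k′ , D-flat , _) , _)) =
  second-after-cliffed-plateau α k≥1 plateau cliff (step⇒second≡pred-first α D-anti (D-flat 1 ≤-refl 1<k′))
no-rightSon α {k} k≥1 plateau cliff (inj₂ (l , l≥1 , (_ , _ , flat , slip) , _)) =
  flat-cliff-not-slip α (constant⇒d≡0 α plateau)
    (d-cliff α (subst (λ x → 2 + at α (suc k) ≤ x) (sym (plateau k k≥1 ≤-refl)) cliff)) flat slip k≥1 (s≤s z≤n)

module _ (m : ℕ) where
  private
    T : Vec ℕ (suc (suc m))
    T = twoOnes (suc (suc m))

  twoOnes-ones : ∀ i → 2 ≤ i → i ≤ suc m → at T i ≡ 1
  twoOnes-ones (suc zero)    (s≤s ()) _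
  twoOnes-ones (suc (suc i)) _        (s≤s i<m) = at-ones-< i<m

  twoOnes-zeros : ∀ i → suc m < i → at T i ≡ 0
  twoOnes-zeros (suc (suc i)) (s≤s (s≤s m≤i)) = at-ones-≥ m≤i

  twoOnes-small : ∀ i → 2 ≤ i → at T i ≤ 1
  twoOnes-small i i≥2 with i ≤? suc m
  ... | yes i≤m+1 = ≤-reflexive (twoOnes-ones i i≥2 i≤m+1)
  ... | no i≰m+1  = ≤-trans (≤-reflexive (twoOnes-zeros i (≰⇒> i≰m+1))) z≤n

  twoOnes-isPartition : IsPartition (suc (suc m)) T
  twoOnes-isPartition = anti , cong (λ x → 2 + x) (sum-ones m)
    where
    anti : NonIncreasing T
    anti (suc zero)    _ = ≤-trans (twoOnes-small 2 ≤-refl) (s≤s z≤n)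
    anti (suc (suc i)) _ with suc (suc (suc i)) ≤? suc m
    ... | yes i+3≤m+1 = ≤-reflexive (trans (twoOnes-ones _ (s≤s (s≤s z≤n)) i+3≤m+1)
                                           (sym (twoOnes-ones _ (s≤s (s≤s z≤n)) (≤-trans (n≤1+n _) i+3≤m+1))))
    ... | no i+3≰m+1  = ≤-trans (≤-reflexive (twoOnes-zeros _ (≰⇒> i+3≰m+1))) z≤n

private
  twoOnes-ext : ∀ {n q} (v : Vec ℕ n) → n ≡ suc (suc q) → at v 1 ≡ 2 →
                (∀ m → 2 ≤ m → m ≤ suc q → at v m ≡ 1) → (∀ m → suc q < m → at v m ≡ 0) → v ≡ twoOnes n
  twoOnes-ext {q = q} v refl v₁ ones zeros = at-ext v (twoOnes (suc (suc q))) same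
    where
    same : ∀ m → 1 ≤ m → at v m ≡ at (twoOnes (suc (suc q))) m
    same (suc zero) _ = v₁
    same m@(suc (suc _)) _ with m ≤? suc q
    ... | yes m≤q+1 = trans (ones m (s≤s (s≤s z≤n)) m≤q+1) (sym (twoOnes-ones q m (s≤s (s≤s z≤n)) m≤q+1))
    ... | no m≰q+1  = trans (zeros m (≰⇒> m≰q+1)) (sym (twoOnes-zeros q m (≰⇒> m≰q+1)))

twoOnes-unique : ∀ {n} (v : Vec ℕ n) {q} → IsPartition n v → 1 ≤ q → at v 1 ≡ 2 →
                 (∀ m → 2 ≤ m → m ≤ q → at v m ≡ 1) → at v (suc q) ≡ 0 → v ≡ twoOnes n
twoOnes-unique {n} v {suc q} (anti , sum≡) _ v₁ ones v₀ = twoOnes-ext v n≡ v₁ ones zeros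
  where
  zeros : ∀ m → suc q < m → at v m ≡ 0
  zeros m q<m = n≤0⇒n≡0 (≤-trans (antitone-≤ anti (s≤s z≤n) q<m) (≤-reflexive v₀))
  psum-ones : ∀ m → suc m ≤ suc q → psum v (suc m) ≡ 2 + m
  psum-ones zero    _   = v₁
  psum-ones (suc m) m+2≤q+1 = trans (cong₂ _+_ (psum-ones m (<⇒≤ m+2≤q+1)) (ones (suc (suc m)) (s≤s (s≤s z≤n)) m+2≤q+1))
                                (cong suc (+-comm (suc m) 1))
  psum-after : ∀ t → psum v (t + suc q) ≡ psum v (suc q)
  psum-after zero    = refl
  psum-after (suc t) = trans (cong₂ _+_ (psum-after t) (zeros (suc (t + suc q)) (s≤s (m≤n+m (suc q) t)))) (+-identityʳ _)
  n≡ : n ≡ suc (suc q)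
  n≡ = begin
    n                    ≡⟨ sum≡ ⟨
    sum v                ≡⟨ psum-sum v (m≤m+n n (suc q)) ⟨
    psum v (n + suc q)   ≡⟨ psum-after n ⟩
    psum v (suc q)       ≡⟨ psum-ones q ≤-refl ⟩
    suc (suc q)          ∎
    where open ≡-Reasoning

-- Sons of a join-irreducible partition

module _ {n} (α : Vec ℕ n) (JI : JoinIrr n α) where
  private
    P : IsPartition n α
    P = proj₁ JI
    anti : NonIncreasing α
    anti = proj₁ P
    f : ℕ → ℕ
    f = at α
    L : Vec ℕ (suc n)
    L = leftSon α

  joinIrr-top≥2 : 2 ≤ at α 1
  joinIrr-top≥2 = let (i , j , M) = joinIrr⇒move α JI in ≤-trans (Move-start≥2 M) (antitone-≤ anti ≤-refl (start≥1 M))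

  leftSon-top : at L 1 ≡ suc (f 1)
  leftSon-top = at-down-≡ α ≤-refl (s≤s z≤n)

  leftSon-rest : ∀ {m} → 2 ≤ m → at L m ≡ f m
  leftSon-rest m≥2 = at-down-≢ α (λ { refl → 1+n≰n m≥2 })

  leftSon-isPartition : IsPartition (suc n) L
  leftSon-isPartition = down-isPartition α P ≤-refl (s≤s z≤n) λ { k k≥1 refl → ⊥-elim (1+n≰n k≥1) }

  move-to-leftSon : ∀ {i j} → 2 ≤ i → Move f i j → Move (at L) i j
  move-to-leftSon i≥2 = Move-transport λ m i≤m _ → leftSon-rest (≤-trans i≥2 i≤m)

  move-from-leftSon : ∀ {i j} → 2 ≤ i → Move (at L) i j → Move f i j
  move-from-leftSon i≥2 = Move-transport λ m i≤m _ → sym (leftSon-rest (≤-trans i≥2 i≤m))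

  leftSon-not-joinIrr : ∀ {i j j′} → Move (at L) 1 j → 2 ≤ i → Move f i j′ → ¬ JoinIrr (suc n) L
  leftSon-not-joinIrr M₁ i≥2 M JI-L =
    1+n≰n (≤-trans i≥2 (≤-reflexive (sym (joinIrr⇒unique-start L JI-L M₁ (move-to-leftSon i≥2 M)))))

  module _ {k} (k≥1 : 1 ≤ k) (plateau : Plateau f 1 k) where
    private
      A : ℕ
      A = f 1
      f-k : f k ≡ A
      f-k = plateau k k≥1 ≤-refl
      k≤n : k ≤ n
      k≤n = ≮⇒≥ λ n<k →
        1+n≰n (≤-trans (≤-trans (s≤s z≤n) joinIrr-top≥2) (≤-reflexive (trans (sym f-k) (at-out α n<k))))

    leftSon-joinIrr-if-cliff : 2 + f (suc k) ≤ A → JoinIrr (suc n) L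
    leftSon-joinIrr-if-cliff cliff = unique-move⇒joinIrr L leftSon-isPartition M-L unique
      where
      cliff-k : 2 + f (suc k) ≤ f k
      cliff-k = subst (2 + f (suc k) ≤_) (sym f-k) cliff
      M-k : Move f k (suc k)
      M-k = cliff-move k≥1 cliff-k
      M-L : Move (at L) k (suc k)
      M-L = cliff-move k≥1 (subst (λ x → 2 + x ≤ at L k) (sym (leftSon-rest (s≤s k≥1)))
                                  (≤-trans cliff-k (at-≤-down α ≤-refl (s≤s z≤n) k)))
      unique : ∀ i j → Move (at L) i j → i ≡ k
      unique zero          j M = ⊥-elim (1+n≰n (start≥1 M))
      unique (suc zero)    j M with m≤n⇒m<n∨m≡n k≥1
      ... | inj₂ 1≡k = 1≡k
      ... | inj₁ 1<k = ⊥-elim (no-move-before-cliffed-plateau 1<k leftSon-top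
                                 (λ m 1<m m≤k → trans (leftSon-rest 1<m) (plateau m (<⇒≤ 1<m) m≤k))
                                 (subst (λ x → 2 + x ≤ A) (sym (leftSon-rest (s≤s k≥1))) cliff) M)
      unique (suc (suc i)) j M = joinIrr⇒unique-start α JI (move-from-leftSon (s≤s (s≤s z≤n)) M) M-k

    module _ (slip : A ≡ suc (f (suc k))) {k₂} (k<k₂ : k < k₂) (plateau₂ : Plateau f (suc k) k₂) where
      private
        c : ℕ
        c = f (suc k)
        R : Vec ℕ (suc n)
        R = down α (suc k)
        k₂≥2 : 2 ≤ k₂
        k₂≥2 = ≤-trans (s≤s k≥1) k<k₂
        f-k₂ : f k₂ ≡ c
        f-k₂ = plateau₂ k₂ k<k₂ ≤-refl

      rightSon-top : ∀ m → 1 ≤ m → m ≤ suc k → at R m ≡ A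
      rightSon-top m m≥1 m≤k+1 with m ≟ suc k
      ... | yes refl = trans (at-down-≡ α (s≤s z≤n) (s≤s k≤n)) (sym slip)
      ... | no m≢k+1 = trans (at-down-≢ α m≢k+1) (plateau m m≥1 (≤-pred (≤∧≢⇒< m≤k+1 m≢k+1)))

      rightSon-plateau : Plateau (at R) 1 (suc k)
      rightSon-plateau m m≥1 m≤k+1 = trans (rightSon-top m m≥1 m≤k+1) (sym (rightSon-top 1 ≤-refl (s≤s z≤n)))

      rightSon-after : ∀ {m} → suc k < m → at R m ≡ f m
      rightSon-after k+1<m = at-down-≢ α (λ e → <⇒≢ k+1<m (sym e))

      rightSon-isPartition : IsPartition (suc n) R
      rightSon-isPartition = down-isPartition α P (s≤s z≤n) (s≤s k≤n) λ { k′ _ refl →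
        subst (c <_) (sym f-k) (subst (c <_) (sym slip) ≤-refl) }

      leftSon-move-from-1 : Move (at L) 1 (suc k)
      leftSon-move-from-1 = move-over-plateau ≤-refl k≥1 leftSon-top
        (λ m 1<m m≤k → trans (leftSon-rest 1<m) (plateau m (<⇒≤ 1<m) m≤k))
        (trans slip (cong suc (sym (leftSon-rest (s≤s k≥1)))))

      is-rightSon : 2 + f (suc k₂) ≤ c ⊎ c ≡ suc (f (suc k₂)) → RightSon n α R
      is-rightSon end with m≤n⇒m<n∨m≡n k≥1
      ... | inj₁ 1<k = plateau-rightSon α P 1<k plateau (trans f-k slip)
      ... | inj₂ 1≡k = subst (λ x → RightSon n α (down α (suc x))) 1≡k
                         (step-rightSon α P slip k₂≥2
                           (λ m m≥2 m≤k₂ → plateau₂ m (subst (λ x → suc x ≤ m) 1≡k m≥2) m≤k₂) end)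

      sons-if-cliff : 2 + f (suc k₂) ≤ c → ¬ JoinIrr (suc n) L × JoinIrr (suc n) R
      sons-if-cliff cliff₂ = leftSon-not-joinIrr leftSon-move-from-1 k₂≥2 M₂ ,
                             unique-move⇒joinIrr R rightSon-isPartition M-R unique
        where
        M₂ : Move f k₂ (suc k₂)
        M₂ = cliff-move (≤-trans (s≤s z≤n) k₂≥2) (subst (2 + f (suc k₂) ≤_) (sym f-k₂) cliff₂)
        M-R : Move (at R) k₂ (suc k₂)
        M-R = cliff-move (≤-trans (s≤s z≤n) k₂≥2)
                (subst (λ x → 2 + x ≤ at R k₂) (sym (rightSon-after (s≤s k<k₂)))
                  (≤-trans (subst (2 + f (suc k₂) ≤_) (sym f-k₂) cliff₂) (at-≤-down α (s≤s z≤n) (s≤s k≤n) k₂)))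
        unique : ∀ i j → Move (at R) i j → i ≡ k₂
        unique i j M with <-cmp i (suc k)
        ... | tri< i<k+1 _ _ = ⊥-elim (<-irrefl (trans (rightSon-plateau (suc i) (s≤s z≤n) i<k+1)
                                                       (sym (rightSon-plateau i (start≥1 M) (<⇒≤ i<k+1))))
                                                 (Move-descent M))
        ... | tri> _ _ k+1<i = joinIrr⇒unique-start α JI
                                 (Move-transport (λ m i≤m _ → sym (rightSon-after (<-≤-trans k+1<i i≤m))) M) M₂
        ... | tri≈ _ refl _ with m≤n⇒m<n∨m≡n k<k₂
        ...   | inj₂ k+1≡k₂ = k+1≡k₂
        ...   | inj₁ k+1<k₂ = ⊥-elim (no-move-before-cliffed-plateau k+1<k₂
                                        (trans (rightSon-top (suc k) (s≤s z≤n) ≤-refl) slip)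
                                        (λ m k+1<m m≤k₂ → trans (rightSon-after k+1<m) (plateau₂ m (<⇒≤ k+1<m) m≤k₂))
                                        (subst (λ x → 2 + x ≤ c) (sym (rightSon-after (s≤s k<k₂))) cliff₂) M)

      module _ (slip₂ : c ≡ suc (f (suc k₂))) where
        private
          M₂ : Move f k (suc k₂)
          M₂ = move-over-plateau k≥1 (<⇒≤ k<k₂) (trans f-k slip) plateau₂ slip₂
          last-zero : f (suc k₂) ≡ 0
          last-zero = n≤0⇒n≡0 (≮⇒≥ λ positive →
            let (i , _ , k₂≤i , M) = move-at-or-after α anti (≤-trans (s≤s z≤n) k₂≥2)
                                       (subst (2 ≤_) (sym (trans f-k₂ slip₂)) (s≤s positive))
            in <-irrefl (joinIrr⇒unique-start α JI M₂ M) (<-≤-trans k<k₂ k₂≤i))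
          c≡1 : c ≡ 1
          c≡1 = trans slip₂ (cong suc last-zero)

        rightSon-joinIrr-if-slip : JoinIrr (suc n) R
        rightSon-joinIrr-if-slip =
          joinIrr-if-small-after-plateau R rightSon-isPartition (s≤s z≤n)
            (subst (2 ≤_) (sym (rightSon-top (suc k) (s≤s z≤n) ≤-refl)) joinIrr-top≥2) rightSon-plateau small
          where
          small : ∀ m → suc k < m → at R m ≤ 1
          small m k+1<m = ≤-trans (≤-reflexive (rightSon-after k+1<m))
                            (≤-trans (antitone-≤ anti (s≤s z≤n) (<⇒≤ k+1<m)) (≤-reflexive c≡1))

        leftSon-not-joinIrr-if-slip : α ≢ twoOnes n → ¬ JoinIrr (suc n) L
        leftSon-not-joinIrr-if-slip α≢T with m≤n⇒m<n∨m≡n k≥1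
        ... | inj₁ 1<k = leftSon-not-joinIrr leftSon-move-from-1 1<k M₂
        ... | inj₂ 1≡k = ⊥-elim (α≢T (twoOnes-unique α P (≤-trans (s≤s z≤n) k₂≥2) (trans slip (cong suc c≡1))
                                        (λ m m≥2 m≤k₂ → trans (plateau₂ m (subst (λ x → suc x ≤ m) 1≡k m≥2) m≤k₂) c≡1)
                                        last-zero))

ExactlyOneSonJoinIrr : (n : ℕ) → Vec ℕ n → Set
ExactlyOneSonJoinIrr n α =
    (JoinIrr (suc n) (leftSon α) × ((β : Vec ℕ (suc n)) → RightSon n α β → ¬ JoinIrr (suc n) β))
  ⊎ (¬ JoinIrr (suc n) (leftSon α) × Σ (Vec ℕ (suc n)) (λ β → RightSon n α β × JoinIrr (suc n) β))

exactly-one-son-joinIrr : ∀ {n} (α : Vec ℕ n) → JoinIrr n α → α ≢ twoOnes n → ExactlyOneSonJoinIrr n α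
exactly-one-son-joinIrr {n} α JI α≢T =
  let (k , k≥1 , plateau , drop) = plateau-end α anti ≤-refl (≤-trans (s≤s z≤n) (joinIrr-top≥2 α JI))
  in after-first-plateau k≥1 plateau drop
  where
  anti : NonIncreasing α
  anti = proj₁ (proj₁ JI)
  f : ℕ → ℕ
  f = at α
  after-second-plateau : ∀ {k k₂} → 1 ≤ k → Plateau f 1 k → f 1 ≡ suc (f (suc k)) →
                         k < k₂ → Plateau f (suc k) k₂ → f (suc k₂) < f (suc k) → ExactlyOneSonJoinIrr n α
  after-second-plateau {k} {k₂} k≥1 plateau slip k<k₂ plateau₂ drop₂ with 2 + f (suc k₂) ≤? f (suc k)
  ... | yes cliff₂ = let (¬JI-L , JI-R) = sons-if-cliff α JI k≥1 plateau slip k<k₂ plateau₂ cliff₂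
                     in inj₂ (¬JI-L , down α (suc k) , is-rightSon α JI k≥1 plateau slip k<k₂ plateau₂ (inj₁ cliff₂) , JI-R)
  ... | no ¬cliff₂ = inj₂ (leftSon-not-joinIrr-if-slip α JI k≥1 plateau slip k<k₂ plateau₂ slip₂ α≢T , down α (suc k) ,
                           is-rightSon α JI k≥1 plateau slip k<k₂ plateau₂ (inj₂ slip₂) ,
                           rightSon-joinIrr-if-slip α JI k≥1 plateau slip k<k₂ plateau₂ slip₂)
    where
    slip₂ : f (suc k) ≡ suc (f (suc k₂))
    slip₂ = ≤-antisym (≤-pred (≰⇒> ¬cliff₂)) drop₂
  after-first-plateau : ∀ {k} → 1 ≤ k → Plateau f 1 k → f (suc k) < f 1 → ExactlyOneSonJoinIrr n α
  after-first-plateau {k} k≥1 plateau drop with 2 + f (suc k) ≤? f 1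
  ... | yes cliff = inj₁ (leftSon-joinIrr-if-cliff α JI k≥1 plateau cliff , λ β rs _ → no-rightSon α k≥1 plateau cliff rs)
  ... | no ¬cliff =
    let slip = ≤-antisym (≤-pred (≰⇒> ¬cliff)) drop
        (k₂ , k<k₂ , plateau₂ , drop₂) = plateau-end α anti (s≤s z≤n) (≤-pred (subst (2 ≤_) slip (joinIrr-top≥2 α JI)))
    in after-second-plateau k≥1 plateau slip k<k₂ plateau₂ drop₂

TwoOnesSonsJoinIrr : ℕ → Set
TwoOnesSonsJoinIrr n = JoinIrr n (twoOnes n) × JoinIrr (suc n) (leftSon (twoOnes n)) ×
  Σ (Vec ℕ (suc n)) (λ β → RightSon n (twoOnes n) β × β ≢ leftSon (twoOnes n) × JoinIrr (suc n) β)

twoOnes-sons-joinIrr : ∀ m → 1 ≤ m → TwoOnesSonsJoinIrr (suc (suc m))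
twoOnes-sons-joinIrr m m≥1 =
  JI-T , JI-L , down T 2 ,
  is-rightSon T JI-T ≤-refl plateau-point slip k<k₂ plateau₂ (inj₂ slip₂) ,
  sons-differ ,
  rightSon-joinIrr-if-slip T JI-T ≤-refl plateau-point slip k<k₂ plateau₂ slip₂
  where
  T : Vec ℕ (suc (suc m))
  T = twoOnes (suc (suc m))
  JI-T : JoinIrr (suc (suc m)) T
  JI-T = joinIrr-if-small-after-plateau T (twoOnes-isPartition m) ≤-refl ≤-refl plateau-point (twoOnes-small m)
  JI-L : JoinIrr (suc (suc (suc m))) (leftSon T)
  JI-L = joinIrr-if-small-after-plateau (leftSon T) (leftSon-isPartition T JI-T) ≤-refl
           (subst (2 ≤_) (sym (leftSon-top T JI-T)) (s≤s (s≤s z≤n))) plateau-point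
           (λ i 1<i → ≤-trans (≤-reflexive (leftSon-rest T JI-T 1<i)) (twoOnes-small m i 1<i))
  sons-differ : down T 2 ≢ leftSon T
  sons-differ e = 1+n≰n (≤-reflexive (trans (sym (leftSon-top T JI-T))
                                            (trans (cong (λ w → at w 1) (sym e)) (at-down-≢ T {2} {1} (λ ())))))
  T₂ : at T 2 ≡ 1
  T₂ = twoOnes-ones m 2 ≤-refl (s≤s m≥1)
  slip : at T 1 ≡ suc (at T 2)
  slip = cong suc (sym T₂)
  k<k₂ : 1 < suc m
  k<k₂ = s≤s m≥1
  plateau₂ : Plateau (at T) 2 (suc m)
  plateau₂ i i≥2 i≤m+1 = trans (twoOnes-ones m i i≥2 i≤m+1) (sym T₂)
  slip₂ : at T 2 ≡ suc (at T (suc (suc m)))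
  slip₂ = trans T₂ (cong suc (sym (twoOnes-zeros m (suc (suc m)) ≤-refl)))

proposition2 : (n : ℕ) → 3 ≤ n →
    ((α : Vec ℕ n) → JoinIrr n α → α ≢ twoOnes n →
        (JoinIrr (suc n) (leftSon α) × ((β : Vec ℕ (suc n)) → RightSon n α β → ¬ JoinIrr (suc n) β))
      ⊎ (¬ JoinIrr (suc n) (leftSon α) × Σ (Vec ℕ (suc n)) (λ β → RightSon n α β × JoinIrr (suc n) β)))
    × (JoinIrr n (twoOnes n) × JoinIrr (suc n) (leftSon (twoOnes n))
        × Σ (Vec ℕ (suc n)) (λ β → RightSon n (twoOnes n) β × β ≢ leftSon (twoOnes n) × JoinIrr (suc n) β))
proposition2 (suc zero)          (s≤s ())
proposition2 (suc (suc zero))    (s≤s (s≤s ()))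
proposition2 (suc (suc (suc m))) _ = exactly-one-son-joinIrr , twoOnes-sons-joinIrr (suc m) (s≤s z≤n)
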